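{- Let $f$ be the function defined in the context. For every integer $k \geq 0$ we have $f(k+1) \leq f(k)+f(\lfloor k/4 \rfloor)$. Consequently, $f(k) \leq 2^{(\log_2 (4k))^2/4}$ for every integer $k \geq 1$.
   Context: All graphs are finite and simple. For a positive integer $k$, $f(k)$ denotes the maximum possible chromatic number of a graph whose edge set can be partitioned into at most $k$ complete bipartite graphs (i.e., $E(G)$ is a disjoint union of the edge sets of at most $k$ complete bipartite subgraphs of $G$). By convention $f(0)=1$. -}

module Defs where

open import Data.Nat using (ℕ; zero; suc; _+_; _*_; _^_; _≤_; _<_; _/_)
open import Data.Bool using (Bool; true; false)
open import Data.Fin using (Fin)
open import Data.Fin.Subset using (Subset; _∈_)
open import Data.Vec using (Vec; lookup)
open import Data.Product using (Σ; ∃; _×_; _,_)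
open import Data.Sum using (_⊎_)
open import Data.Empty using (⊥)
open import Relation.Binary.PropositionalEquality using (_≡_; _≢_)

record Graph : Set where
  field
    n       : ℕ
    adj     : Fin n → Fin n → Bool
    adj-sym : ∀ u v → adj u v ≡ adj v u
    irrefl  : ∀ v → adj v v ≡ false

open Graph public

Edge : (G : Graph) → Fin (n G) → Fin (n G) → Set
Edge G u v = adj G u v ≡ true

-- A complete bipartite graph on vertex set Fin n, given by two disjoint
-- sides L and R; its edges are all pairs with one end in L, the other in R.
record Biclique (m : ℕ) : Set where
  field
    L        : Subset m
    R        : Subset m
    disjoint : ∀ v → v ∈ L → v ∈ R → ⊥

open Biclique public

InBiclique : {m : ℕ} → Biclique m → Fin m → Fin m → Set
InBiclique b u v = (u ∈ L b × v ∈ R b) ⊎ (u ∈ R b × v ∈ L b)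

IsBicliquePartition : (G : Graph) {j : ℕ} → Vec (Biclique (n G)) j → Set
IsBicliquePartition G {j} bs =
  (∀ (i : Fin j) u v → InBiclique (lookup bs i) u v → Edge G u v)
  × (∀ u v → Edge G u v → ∃ λ (i : Fin j) → InBiclique (lookup bs i) u v)
  × (∀ (i i' : Fin j) u v → InBiclique (lookup bs i) u v
        → InBiclique (lookup bs i') u v → i ≡ i')

HasBicliquePartition : Graph → ℕ → Set
HasBicliquePartition G k =
  Σ ℕ λ j → j ≤ k × Σ (Vec (Biclique (n G)) j) λ bs → IsBicliquePartition G bs

Colourable : Graph → ℕ → Set
Colourable G c =
  Σ (Fin (n G) → Fin c) λ col → ∀ u v → Edge G u v → col u ≢ col v

-- f(k) ≤ m : every graph whose edge set partitions into at most k
-- complete bipartite graphs has chromatic number at most m.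
fBoundedBy : ℕ → ℕ → Set
fBoundedBy k m = ∀ (G : Graph) → HasBicliquePartition G k → Colourable G m

-- For a natural number c ≥ 0 and k ≥ 1, the real inequality
--   c ≤ 2^((log₂ (4k))² / 4)
-- stated without reals: for every rational m/n > log₂(4k)
-- (i.e. (4k)^n < 2^m) we have c ≤ 2^(m²/(4n²)), i.e. c^(4n²) ≤ 2^(m²).
BelowBound : ℕ → ℕ → Set
BelowBound k c =
  ∀ (m n : ℕ) → 0 < n → (4 * k) ^ n < 2 ^ m → c ^ (4 * (n * n)) ≤ 2 ^ (m * m)

{-# OPTIONS --safe #-}
module Submission where

-- Let B₀, …, B_k partition E(G), and say that a biclique C meets a vertex set S
-- when both sides of C intersect S. A biclique never meets both sides of another
-- one, and two distinct bicliques never both meet a side of each other: either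
-- way some edge would lie in both. So each of the (k+1)k/2 unordered pairs
-- contributes at most one meeting, and some side S of some B_i is met by at most
-- ⌊k/4⌋ bicliques. The k bicliques other than B_i partition G − S and the
-- bicliques meeting S partition G[S]; colouring these two induced subgraphs with
-- disjoint palettes gives f(k+1) ≤ f(k) + f(⌊k/4⌋). Hence f(k) ≤ (k+1) f(⌊k/4⌋),
-- and if 4k < 2^(j+1) then induction on j in steps of two gives f(k)⁴ ≤ 2^(j²);
-- j = ⌊log₂ 4k⌋ gives the stated bound.

open import Data.Bool using (Bool; true; false; not; _∧_)
open import Data.Bool.Properties using (∧-comm; ∧-zeroʳ; ∧-conicalˡ; ∧-conicalʳ; not-involutive)
open import Data.Empty using (⊥; ⊥-elim)
open import Data.Fin using (Fin; zero; suc; join; splitAt; inject≤; punchIn; _≟_)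
open import Data.Fin.Properties
  using (¬Fin0; splitAt-join; inject≤-injective; suc-injective) renaming (0≢1+n to zero≢suc)
open import Data.Fin.Subset using (Subset; _∈_; _∩_; ∁; Nonempty)
open import Data.Fin.Subset.Properties
  using (_∈?_; nonempty?; x∈p∩q⁺; x∈p∩q⁻; x∈∁p⇒x∉p; x∉p⇒x∈∁p)
open import Data.Nat
  using (ℕ; zero; suc; _+_; _*_; _^_; _≤_; _<_; _/_; _%_; z≤n; s≤s; s≤s⁻¹; NonZero)
open import Data.Nat.DivMod using (m≡m%n+[m/n]*n; m%n<n; m/n*n≤m; /-monoˡ-≤)
open import Data.Nat.Properties
  using ( +-0-commutativeMonoid; +-*-commutativeSemiring; module ≤-Reasoning
        ; _<?_; _≤?_; ≤-refl; ≤-reflexive; ≤-trans; ≤-<-trans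
        ; <⇒≤; <⇒≱; ≮⇒≥; ≰⇒>; ≰⇒≥
        ; m≤n⇒m<n∨m≡n; n≤1+n; n<1+n; m≤m+n; m≤m*n; m≤n*m
        ; +-comm; +-mono-≤; +-monoˡ-≤; +-monoˡ-<; +-cancelˡ-<
        ; *-comm; *-assoc; *-identityˡ; *-identityʳ; *-distribˡ-+
        ; *-mono-≤; *-monoʳ-<; *-cancelˡ-<
        ; m^n>0; ^-monoˡ-≤; ^-monoʳ-≤; ^-monoʳ-<; ^-*-assoc; ^-distribˡ-+-* )
open import Algebra.Properties.CommutativeMonoid.Sum +-0-commutativeMonoid
  using (sum; sum-syntax; ∑-comm; ∑-distrib-+; sum-cong-≗; sum-remove)
open import Algebra.Properties.CommutativeSemiring.Exp +-*-commutativeSemiring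
  using (^-distrib-*)
open import Data.Nat.Tactic.RingSolver using (solve-∀)
open import Data.Product using (Σ; ∃; ∃₂; _×_; _,_; proj₁; proj₂)
open import Data.Sum using (_⊎_; inj₁; inj₂; [_,_]′)
open import Data.Sum.Properties using (inj₁-injective; inj₂-injective)
open import Data.Vec using (Vec; []; _∷_; lookup)
open import Data.Vec.Functional using (removeAt)
open import Data.Vec.Properties using (lookup⇒[]=; []=⇒lookup)
open import Function using (_∘_)
open import Relation.Binary.PropositionalEquality
open import Relation.Nullary using (¬_; Dec; yes; no)
open import Relation.Nullary.Decidable using (_×-dec_; _⊎-dec_; ¬?; decidable-stable)
open import Relation.Unary using (Decidable)

open import Defs

indicator : {P : Set} → Dec P → ℕ
indicator (yes _) = 1
indicator (no _)  = 0

count : {j : ℕ} {P : Fin j → Set} → Decidable P → ℕ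
count {j} P? = ∑[ i < j ] indicator (P? i)

indicator≤1 : {P : Set} (p : Dec P) → indicator p ≤ 1
indicator≤1 (yes _) = s≤s z≤n
indicator≤1 (no _)  = z≤n

indicator-no : {P : Set} → ¬ P → (p : Dec P) → indicator p ≡ 0
indicator-no ¬p (yes p) = ⊥-elim (¬p p)
indicator-no ¬p (no _)  = refl

indicator-⊎ : {P Q : Set} → (P → Q → ⊥) → (p : Dec P) (q : Dec Q) →
              indicator p + indicator q ≡ indicator (p ⊎-dec q)
indicator-⊎ excl (yes p) (yes q) = ⊥-elim (excl p q)
indicator-⊎ excl (yes _) (no _)  = refl
indicator-⊎ excl (no _)  (yes _) = refl
indicator-⊎ excl (no _)  (no _)  = refl

sum-mono-≤ : ∀ {m} {f g : Fin m → ℕ} → (∀ i → f i ≤ g i) → sum f ≤ sum g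
sum-mono-≤ {zero}  f≤g = z≤n
sum-mono-≤ {suc m} f≤g = +-mono-≤ (f≤g zero) (sum-mono-≤ (f≤g ∘ suc))

sum-const : ∀ m c → ∑[ i < m ] c ≡ m * c
sum-const zero    c = refl
sum-const (suc m) c = cong (c +_) (sum-const m c)

sum-≤-pred : ∀ {k} (f : Fin (suc k) → ℕ) i → f i ≡ 0 → (∀ i' → f i' ≤ 1) → sum f ≤ k
sum-≤-pred {k} f i fi≡0 f≤1 = begin
  sum f                    ≡⟨ sum-remove {i = i} f ⟩
  f i + sum (removeAt f i) ≡⟨ cong (_+ sum (removeAt f i)) fi≡0 ⟩
  sum (removeAt f i)       ≤⟨ sum-mono-≤ (f≤1 ∘ punchIn i) ⟩
  ∑[ i' < k ] 1            ≡⟨ sum-const k 1 ⟩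
  k * 1                    ≡⟨ *-identityʳ k ⟩
  k                        ∎
  where open ≤-Reasoning

sum<*⇒∃< : ∀ {m} (f : Fin m → ℕ) c → sum f < m * c → ∃ λ i → f i < c
sum<*⇒∃< {suc m} f c ∑f<m*c with f zero <? c
... | yes f₀<c = zero , f₀<c
... | no  f₀≮c =
  let c+∑<c+m*c = ≤-<-trans (+-monoˡ-≤ (sum (f ∘ suc)) (≮⇒≥ f₀≮c)) ∑f<m*c
      i , fi<c   = sum<*⇒∃< (f ∘ suc) c (+-cancelˡ-< c _ _ c+∑<c+m*c)
  in suc i , fi<c

sum-tournament : ∀ {k} (X : Fin (suc k) → Fin (suc k) → ℕ) →
                 (∀ i → X i i ≡ 0) → (∀ i j → X i j + X j i ≤ 1) →
                 let T = ∑[ i < suc k ] ∑[ j < suc k ] X i j in T + T ≤ suc k * k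
sum-tournament {k} X X-diag X-pair = begin
  sum row + sum row                              ≡⟨ cong (sum row +_) (∑-comm (λ j i → X i j)) ⟨
  sum row + sum column                           ≡⟨ ∑-distrib-+ row column ⟨
  ∑[ i < suc k ] (row i + column i)              ≡⟨ sum-cong-≗ (λ i → ∑-distrib-+ (X i) (X′ i)) ⟨
  ∑[ i < suc k ] ∑[ j < suc k ] (X i j + X j i)  ≤⟨ sum-mono-≤ row+column≤k ⟩
  ∑[ i < suc k ] k                               ≡⟨ sum-const (suc k) k ⟩
  suc k * k                                      ∎
  where
  open ≤-Reasoning
  X′ : Fin (suc k) → Fin (suc k) → ℕ
  X′ i j = X j i
  row column : Fin (suc k) → ℕ
  row    i = ∑[ j < suc k ] X i j
  column i = ∑[ j < suc k ] X j i
  row+column≤k : ∀ i → ∑[ j < suc k ] (X i j + X j i) ≤ k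
  row+column≤k i = sum-≤-pred _ i (cong₂ _+_ (X-diag i) (X-diag i)) (X-pair i)

m<[1+m/n]*n : ∀ m n .{{_ : NonZero n}} → m < suc (m / n) * n
m<[1+m/n]*n m n = begin-strict
  m                 ≡⟨ m≡m%n+[m/n]*n m n ⟩
  m % n + m / n * n <⟨ +-monoˡ-< (m / n * n) (m%n<n m n) ⟩
  n + m / n * n     ∎
  where open ≤-Reasoning

m+m<n+n⇒m<n : ∀ {m n} → m + m < n + n → m < n
m+m<n+n⇒m<n m+m<n+n = ≰⇒> λ n≤m → <⇒≱ m+m<n+n (+-mono-≤ n≤m n≤m)

m+n<2[1+q]⇒m≤q⊎n≤q : ∀ {m n} q → m + n < suc q + suc q → m ≤ q ⊎ n ≤ q
m+n<2[1+q]⇒m≤q⊎n≤q {m} {n} q m+n< with m ≤? q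
... | yes m≤q = inj₁ m≤q
... | no  m≰q =
  inj₂ (s≤s⁻¹ (+-cancelˡ-< (suc q) n (suc q) (≤-<-trans (+-monoˡ-≤ n (≰⇒> m≰q)) m+n<)))

induced : (G : Graph) → Subset (n G) → Graph
induced G S = record
  { n       = n G
  ; adj     = λ u v → (lookup S u ∧ lookup S v) ∧ adj G u v
  ; adj-sym = λ u v → cong₂ _∧_ (∧-comm (lookup S u) (lookup S v)) (adj-sym G u v)
  ; irrefl  = λ v → trans (cong ((lookup S v ∧ lookup S v) ∧_) (irrefl G v)) (∧-zeroʳ _)
  }

induced-edge⁺ : ∀ G S {u v} → u ∈ S → v ∈ S → Edge G u v → Edge (induced G S) u v
induced-edge⁺ G S u∈S v∈S e rewrite []=⇒lookup u∈S | []=⇒lookup v∈S = e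

induced-edge⁻ : ∀ G S {u v} → Edge (induced G S) u v → u ∈ S × v ∈ S × Edge G u v
induced-edge⁻ G S {u} {v} e =
  lookup⇒[]= u S (∧-conicalˡ _ _ uv∈S) , lookup⇒[]= v S (∧-conicalʳ _ _ uv∈S) ,
  ∧-conicalʳ _ _ e
  where
  uv∈S : lookup S u ∧ lookup S v ≡ true
  uv∈S = ∧-conicalˡ _ _ e

colourable-mono : ∀ {G b b'} → b ≤ b' → Colourable G b → Colourable G b'
colourable-mono b≤b' (col , proper) =
  (λ v → inject≤ (col v) b≤b') ,
  λ u v e eq → proper u v e (inject≤-injective b≤b' b≤b' _ _ eq)

join-injective : ∀ b c {x y : Fin b ⊎ Fin c} → join b c x ≡ join b c y → x ≡ y
join-injective b c {x} {y} eq = begin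
  x                    ≡⟨ splitAt-join b c x ⟨
  splitAt b (join b c x) ≡⟨ cong (splitAt b) eq ⟩
  splitAt b (join b c y) ≡⟨ splitAt-join b c y ⟩
  y                    ∎
  where open ≡-Reasoning

colourable-split : ∀ G S {b c} → Colourable (induced G (∁ S)) b → Colourable (induced G S) c →
                   Colourable G (b + c)
colourable-split G S {b} {c} (col₁ , proper₁) (col₂ , proper₂) =
  join b c ∘ colour , λ u v e → proper u v e ∘ join-injective b c
  where
  colour : Fin (n G) → Fin b ⊎ Fin c
  colour w with w ∈? S
  ... | yes _ = inj₂ (col₂ w)
  ... | no  _ = inj₁ (col₁ w)
  proper : ∀ u v → Edge G u v → colour u ≢ colour v
  proper u v e eq with u ∈? S | v ∈? S | eq
  ... | yes u∈S | yes v∈S | eq' = proper₂ u v (induced-edge⁺ G S u∈S v∈S e) (inj₂-injective eq')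
  ... | no  u∉S | no  v∉S | eq' =
    proper₁ u v (induced-edge⁺ G (∁ S) (x∉p⇒x∈∁p u∉S) (x∉p⇒x∈∁p v∉S) e)
                (inj₁-injective eq')

restrict : ∀ {m} → Subset m → Biclique m → Biclique m
restrict S B = record
  { L        = L B ∩ S
  ; R        = R B ∩ S
  ; disjoint = λ v v∈L∩S v∈R∩S →
      disjoint B v (proj₁ (x∈p∩q⁻ (L B) S v∈L∩S)) (proj₁ (x∈p∩q⁻ (R B) S v∈R∩S))
  }

restrict-edge⁺ : ∀ {m} (S : Subset m) (B : Biclique m) {u v} →
                 InBiclique B u v → u ∈ S → v ∈ S → InBiclique (restrict S B) u v
restrict-edge⁺ S B (inj₁ (u∈L , v∈R)) u∈S v∈S =
  inj₁ (x∈p∩q⁺ (u∈L , u∈S) , x∈p∩q⁺ (v∈R , v∈S))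
restrict-edge⁺ S B (inj₂ (u∈R , v∈L)) u∈S v∈S =
  inj₂ (x∈p∩q⁺ (u∈R , u∈S) , x∈p∩q⁺ (v∈L , v∈S))

restrict-edge⁻ : ∀ {m} (S : Subset m) (B : Biclique m) {u v} →
                 InBiclique (restrict S B) u v → InBiclique B u v × u ∈ S × v ∈ S
restrict-edge⁻ S B (inj₁ (u∈L∩S , v∈R∩S)) =
  let u∈L , u∈S = x∈p∩q⁻ (L B) S u∈L∩S
      v∈R , v∈S = x∈p∩q⁻ (R B) S v∈R∩S
  in inj₁ (u∈L , v∈R) , u∈S , v∈S
restrict-edge⁻ S B (inj₂ (u∈R∩S , v∈L∩S)) =
  let u∈R , u∈S = x∈p∩q⁻ (R B) S u∈R∩S
      v∈L , v∈S = x∈p∩q⁻ (L B) S v∈L∩S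
  in inj₂ (u∈R , v∈L) , u∈S , v∈S

inBiclique? : ∀ {m} (B : Biclique m) u v → Dec (InBiclique B u v)
inBiclique? B u v = ((u ∈? L B) ×-dec (v ∈? R B)) ⊎-dec ((u ∈? R B) ×-dec (v ∈? L B))

Edgeless : ∀ {m} → Biclique m → Set
Edgeless B = ∀ u v → ¬ InBiclique B u v

restrict-∁-edgeless : ∀ {m} {S : Subset m} (B : Biclique m) →
                      (∀ u v → InBiclique B u v → u ∈ S ⊎ v ∈ S) → Edgeless (restrict (∁ S) B)
restrict-∁-edgeless {S = S} B hits u v e with restrict-edge⁻ (∁ S) B e
... | uv∈B , u∈∁S , v∈∁S with hits u v uv∈B
...   | inj₁ u∈S = x∈∁p⇒x∉p u∈∁S u∈S
...   | inj₂ v∈S = x∈∁p⇒x∉p v∈∁S v∈S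

-- IsBicliquePartition and HasBicliquePartition for an arbitrary edge relation, so that
-- bicliques can be peeled off one at a time; at E = Edge G they agree with the
-- originals by definition.
IsPartition : ∀ {m j} → (Fin m → Fin m → Set) → (Fin j → Biclique m) → Set
IsPartition E B =
  (∀ i u v → InBiclique (B i) u v → E u v)
  × (∀ u v → E u v → ∃ λ i → InBiclique (B i) u v)
  × (∀ i i' u v → InBiclique (B i) u v → InBiclique (B i') u v → i ≡ i')

PartitionableBy : ∀ {m} → (Fin m → Fin m → Set) → ℕ → Set
PartitionableBy {m} E k =
  Σ ℕ λ j → j ≤ k × Σ (Vec (Biclique m) j) λ bs → IsPartition E (lookup bs)

partitionableBy-mono : ∀ {m} {E : Fin m → Fin m → Set} {k k'} →
                       k ≤ k' → PartitionableBy E k → PartitionableBy E k'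
partitionableBy-mono k≤k' (j , j≤k , bs , part) = j , ≤-trans j≤k k≤k' , bs , part

isPartition-induced : ∀ G {j} {B : Fin j → Biclique (n G)} S →
                      IsPartition (Edge G) B → IsPartition (Edge (induced G S)) (restrict S ∘ B)
isPartition-induced G {B = B} S (inE , cover , unique) = inE' , cover' , unique'
  where
  inE' : ∀ i u v → InBiclique (restrict S (B i)) u v → Edge (induced G S) u v
  inE' i u v e = let uv∈B , u∈S , v∈S = restrict-edge⁻ S (B i) e
                 in induced-edge⁺ G S u∈S v∈S (inE i u v uv∈B)
  cover' : ∀ u v → Edge (induced G S) u v → ∃ λ i → InBiclique (restrict S (B i)) u v
  cover' u v e = let u∈S , v∈S , e' = induced-edge⁻ G S e
                     i , uv∈B = cover u v e'
                 in i , restrict-edge⁺ S (B i) uv∈B u∈S v∈S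
  unique' : ∀ i i' u v → InBiclique (restrict S (B i)) u v → InBiclique (restrict S (B i')) u v →
            i ≡ i'
  unique' i i' u v e e' =
    unique i i' u v (proj₁ (restrict-edge⁻ S (B i) e)) (proj₁ (restrict-edge⁻ S (B i') e'))

_∖_ : ∀ {m} → (Fin m → Fin m → Set) → Biclique m → Fin m → Fin m → Set
(E ∖ B) u v = E u v × ¬ InBiclique B u v

isPartition-tail : ∀ {m j} {E : Fin m → Fin m → Set} {B : Fin (suc j) → Biclique m} →
                   IsPartition E B → IsPartition (E ∖ B zero) (B ∘ suc)
isPartition-tail {E = E} {B} (inE , cover , unique) =
  (λ i u v e → inE (suc i) u v e , λ e₀ → zero≢suc (unique zero (suc i) u v e₀ e)) ,
  cover' ,
  (λ i i' u v e e' → suc-injective (unique (suc i) (suc i') u v e e'))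
  where
  cover' : ∀ u v → (E ∖ B zero) u v → ∃ λ i → InBiclique (B (suc i)) u v
  cover' u v (e , e∉B₀) with cover u v e
  ... | zero  , e∈B₀ = ⊥-elim (e∉B₀ e∈B₀)
  ... | suc i , e∈Bᵢ = i , e∈Bᵢ

isPartition-tail-edgeless : ∀ {m j} {E : Fin m → Fin m → Set} {B : Fin (suc j) → Biclique m} →
                            Edgeless (B zero) → IsPartition E B → IsPartition E (B ∘ suc)
isPartition-tail-edgeless {B = B} B₀-edgeless part =
  let inE , cover , unique = isPartition-tail {B = B} part
  in (λ i u v e → proj₁ (inE i u v e)) , (λ u v e → cover u v (e , B₀-edgeless u v)) , unique

isPartition-∷ : ∀ {m j} {E : Fin m → Fin m → Set} {B : Biclique m} {bs : Vec (Biclique m) j} →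
                (∀ u v → InBiclique B u v → E u v) → IsPartition (E ∖ B) (lookup bs) →
                IsPartition E (lookup (B ∷ bs))
isPartition-∷ {E = E} {B} {bs} B⊆E (inE , cover , unique) = inE' , cover' , unique'
  where
  inE' : ∀ i u v → InBiclique (lookup (B ∷ bs) i) u v → E u v
  inE' zero    = B⊆E
  inE' (suc i) u v e = proj₁ (inE i u v e)
  cover' : ∀ u v → E u v → ∃ λ i → InBiclique (lookup (B ∷ bs) i) u v
  cover' u v e with inBiclique? B u v
  ... | yes e∈B = zero , e∈B
  ... | no  e∉B = let i , e∈bsᵢ = cover u v (e , e∉B) in suc i , e∈bsᵢ
  unique' : ∀ i i' u v → InBiclique (lookup (B ∷ bs) i) u v →
            InBiclique (lookup (B ∷ bs) i') u v → i ≡ i'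
  unique' zero    zero     u v e e' = refl
  unique' zero    (suc i') u v e e' = ⊥-elim (proj₂ (inE i' u v e') e)
  unique' (suc i) zero     u v e e' = ⊥-elim (proj₂ (inE i u v e) e')
  unique' (suc i) (suc i') u v e e' = cong suc (unique i i' u v e e')

prune : ∀ {m j} {E : Fin m → Fin m → Set} (B : Fin j → Biclique m) {P : Fin j → Set}
        (P? : Decidable P) → (∀ i → ¬ P i → Edgeless (B i)) → IsPartition E B →
        PartitionableBy E (count P?)
prune {j = zero} B P? _ (_ , cover , _) =
  0 , z≤n , [] , (λ ()) , (λ u v e → ⊥-elim (¬Fin0 (proj₁ (cover u v e)))) , (λ ())
prune {j = suc j} B P? edgeless part with P? zero
... | no ¬P₀ =
  prune (B ∘ suc) (P? ∘ suc) (edgeless ∘ suc)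
        (isPartition-tail-edgeless {B = B} (edgeless zero ¬P₀) part)
... | yes _ =
  let j' , j'≤ , bs , part' =
        prune (B ∘ suc) (P? ∘ suc) (edgeless ∘ suc) (isPartition-tail {B = B} part)
  in suc j' , s≤s j'≤ , B zero ∷ bs , isPartition-∷ {B = B zero} (proj₁ part zero) part'

Meets : ∀ {m} → Subset m → Biclique m → Set
Meets S B = Nonempty (L B ∩ S) × Nonempty (R B ∩ S)

meets? : ∀ {m} (S : Subset m) → Decidable (Meets S)
meets? S B = nonempty? (L B ∩ S) ×-dec nonempty? (R B ∩ S)

restrict-edge⇒meets : ∀ {m} {S : Subset m} {B : Biclique m} {u v} →
                      InBiclique (restrict S B) u v → Meets S B
restrict-edge⇒meets {u = u} {v} (inj₁ (u∈L∩S , v∈R∩S)) = (u , u∈L∩S) , (v , v∈R∩S)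
restrict-edge⇒meets {u = u} {v} (inj₂ (u∈R∩S , v∈L∩S)) = (v , v∈L∩S) , (u , u∈R∩S)

side : ∀ {m} → Biclique m → Bool → Subset m
side B true  = L B
side B false = R B

side-edge : ∀ {m} (B : Biclique m) s {u v} → u ∈ side B s → v ∈ side B (not s) → InBiclique B u v
side-edge B true  u∈L v∈R = inj₁ (u∈L , v∈R)
side-edge B false u∈R v∈L = inj₂ (u∈R , v∈L)

edge-hits-side : ∀ {m} (B : Biclique m) s u v → InBiclique B u v → u ∈ side B s ⊎ v ∈ side B s
edge-hits-side B true  u v (inj₁ (u∈L , _)) = inj₁ u∈L
edge-hits-side B true  u v (inj₂ (_ , v∈L)) = inj₂ v∈L
edge-hits-side B false u v (inj₁ (_ , v∈R)) = inj₂ v∈R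
edge-hits-side B false u v (inj₂ (u∈R , _)) = inj₁ u∈R

sides-disjoint : ∀ {m} (B : Biclique m) s {x} → x ∈ side B s → x ∈ side B (not s) → ⊥
sides-disjoint B true  x∈L x∈R = disjoint B _ x∈L x∈R
sides-disjoint B false x∈R x∈L = disjoint B _ x∈L x∈R

meets-side : ∀ {m} {S : Subset m} {B : Biclique m} → Meets S B →
             ∀ s → ∃ λ x → x ∈ side B s × x ∈ S
meets-side {S = S} {B} ((x , x∈L∩S) , _) true  = x , x∈p∩q⁻ (L B) S x∈L∩S
meets-side {S = S} {B} (_ , (x , x∈R∩S)) false = x , x∈p∩q⁻ (R B) S x∈R∩S

¬meets-own-side : ∀ {m} (B : Biclique m) s → ¬ Meets (side B s) B
¬meets-own-side B s B-meets =
  let x , x∈side[¬s] , x∈side[s] = meets-side {B = B} B-meets (not s)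
  in sides-disjoint B s x∈side[s] x∈side[¬s]

SharedEdge : ∀ {m} → Biclique m → Biclique m → Set
SharedEdge A C = ∃₂ λ u v → InBiclique A u v × InBiclique C u v

meets-both-sides⇒shared : ∀ {m} (A C : Biclique m) s →
                          Meets (side A s) C → Meets (side A (not s)) C → SharedEdge A C
meets-both-sides⇒shared A C s meets₁ meets₂ =
  let x , x∈L , x∈A = meets-side {S = side A s} {C} meets₁ true
      y , y∈R , y∈A = meets-side {S = side A (not s)} {C} meets₂ false
  in x , y , side-edge A s x∈A y∈A , inj₁ (x∈L , y∈R)

-- Take c on side s of A and side ¬t of C, and a on side t of C and side ¬s of A:
-- then c a is an edge of both.
meets-crossed⇒shared : ∀ {m} (A C : Biclique m) s t →
                       Meets (side A s) C → Meets (side C t) A → SharedEdge A C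
meets-crossed⇒shared A C s t C-meets A-meets =
  let c , c∈C , c∈A = meets-side {S = side A s} {C} C-meets (not t)
      a , a∈A , a∈C = meets-side {S = side C t} {A} A-meets (not s)
  in c , a , side-edge A s c∈A a∈A ,
     side-edge C (not t) c∈C (subst (λ t' → a ∈ side C t') (sym (not-involutive t)) a∈C)

Touches : ∀ {m} → Biclique m → Biclique m → Set
Touches A C = Meets (L A) C ⊎ Meets (R A) C

touches? : ∀ {m} (A C : Biclique m) → Dec (Touches A C)
touches? A C = meets? (L A) C ⊎-dec meets? (R A) C

touches⇒meets-side : ∀ {m} {A C : Biclique m} → Touches A C → ∃ λ s → Meets (side A s) C
touches⇒meets-side (inj₁ meets) = true , meets
touches⇒meets-side (inj₂ meets) = false , meets

module _ {m k : ℕ} (B : Fin (suc k) → Biclique m)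
         (distinct : ∀ i i' → SharedEdge (B i) (B i') → i ≡ i') where

  private
    touching : Fin (suc k) → Fin (suc k) → ℕ
    touching i i' = indicator (touches? (B i) (B i'))

    met-by : Fin (suc k) → Bool → ℕ
    met-by i s = count (λ i' → meets? (side (B i) s) (B i'))

    touching-diag : ∀ i → touching i i ≡ 0
    touching-diag i = indicator-no ¬touches (touches? (B i) (B i))
      where
      ¬touches : ¬ Touches (B i) (B i)
      ¬touches t = let s , meets = touches⇒meets-side {A = B i} {B i} t
                   in ¬meets-own-side (B i) s meets

    touching-pair : ∀ i i' → touching i i' + touching i' i ≤ 1
    touching-pair i i' = begin
      touching i i' + touching i' i          ≡⟨ indicator-⊎ exclusive Bi-touches? Bi'-touches? ⟩
      indicator (Bi-touches? ⊎-dec Bi'-touches?) ≤⟨ indicator≤1 _ ⟩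
      1                                      ∎
      where
      open ≤-Reasoning
      Bi-touches? : Dec (Touches (B i) (B i'))
      Bi-touches? = touches? (B i) (B i')
      Bi'-touches? : Dec (Touches (B i') (B i))
      Bi'-touches? = touches? (B i') (B i)
      exclusive : Touches (B i) (B i') → Touches (B i') (B i) → ⊥
      exclusive t t'
        with touches⇒meets-side {A = B i} {B i'} t | touches⇒meets-side {A = B i'} {B i} t'
      ... | s , meets | s' , meets'
        with refl ← distinct i i' (meets-crossed⇒shared (B i) (B i') s s' meets meets') =
        ¬meets-own-side (B i) s meets

    touching-row : ∀ i → met-by i true + met-by i false ≡ ∑[ i' < suc k ] touching i i'
    touching-row i = begin
      met-by i true + met-by i false
        ≡⟨ ∑-distrib-+ (indicator ∘ meetsˡ?) (indicator ∘ meetsʳ?) ⟨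
      ∑[ i' < suc k ] (indicator (meetsˡ? i') + indicator (meetsʳ? i'))
        ≡⟨ sum-cong-≗ (λ i' → indicator-⊎ (exclusive i') (meetsˡ? i') (meetsʳ? i')) ⟩
      ∑[ i' < suc k ] touching i i'
        ∎
      where
      open ≡-Reasoning
      meetsˡ? : ∀ i' → Dec (Meets (L (B i)) (B i'))
      meetsˡ? i' = meets? (L (B i)) (B i')
      meetsʳ? : ∀ i' → Dec (Meets (R (B i)) (B i'))
      meetsʳ? i' = meets? (R (B i)) (B i')
      exclusive : ∀ i' → Meets (L (B i)) (B i') → Meets (R (B i)) (B i') → ⊥
      exclusive i' meets meets'
        with refl ← distinct i i' (meets-both-sides⇒shared (B i) (B i') true meets meets') =
        ¬meets-own-side (B i) true meets

    q : ℕ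
    q = k / 4

    rows< : ∑[ i < suc k ] (met-by i true + met-by i false) < suc k * (suc q + suc q)
    rows< = m+m<n+n⇒m<n (begin-strict
      M + M                   ≡⟨ cong₂ _+_ M≡T M≡T ⟩
      T + T                   ≤⟨ sum-tournament touching touching-diag touching-pair ⟩
      suc k * k               <⟨ *-monoʳ-< (suc k) (m<[1+m/n]*n k 4) ⟩
      suc k * (suc q * 4)     ≡⟨ cong (suc k *_) (x*4≡2x+2x (suc q)) ⟩
      suc k * (2q′ + 2q′)     ≡⟨ *-distribˡ-+ (suc k) 2q′ 2q′ ⟩
      suc k * 2q′ + suc k * 2q′ ∎)
      where
      open ≤-Reasoning
      M T 2q′ : ℕ
      2q′ = suc q + suc q
      M = ∑[ i < suc k ] (met-by i true + met-by i false)
      T = ∑[ i < suc k ] ∑[ i' < suc k ] touching i i'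
      M≡T : M ≡ T
      M≡T = sum-cong-≗ touching-row
      x*4≡2x+2x : ∀ x → x * 4 ≡ (x + x) + (x + x)
      x*4≡2x+2x = solve-∀

  few-meet-some-side : ∃₂ λ i s → count (λ i' → meets? (side (B i) s) (B i')) ≤ k / 4
  few-meet-some-side =
    let i , row< = sum<*⇒∃< (λ i → met-by i true + met-by i false) (suc q + suc q) rows<
    in i , [ true ,_ , false ,_ ]′ (m+n<2[1+q]⇒m≤q⊎n≤q q row<)

partition-distinct : ∀ {m j} {E : Fin m → Fin m → Set} {B : Fin j → Biclique m} →
                     IsPartition E B → ∀ i i' → SharedEdge (B i) (B i') → i ≡ i'
partition-distinct (_ , _ , unique) i i' (u , v , e , e') = unique i i' u v e e'

partition-outside : ∀ G {k} (B : Fin (suc k) → Biclique (n G)) → IsPartition (Edge G) B →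
                    ∀ i {S} → (∀ u v → InBiclique (B i) u v → u ∈ S ⊎ v ∈ S) →
                    HasBicliquePartition (induced G (∁ S)) k
partition-outside G B part i {S} hits =
  partitionableBy-mono
    (sum-≤-pred _ i (indicator-no (λ i≢i → i≢i refl) (≢i? i)) (indicator≤1 ∘ ≢i?))
    (prune (restrict (∁ S) ∘ B) ≢i? edgeless (isPartition-induced G {B = B} (∁ S) part))
  where
  ≢i? : ∀ i' → Dec (i' ≢ i)
  ≢i? i' = ¬? (i' ≟ i)
  edgeless : ∀ i' → ¬ i' ≢ i → Edgeless (restrict (∁ S) (B i'))
  edgeless i' ¬i'≢i with refl ← decidable-stable (i' ≟ i) ¬i'≢i = restrict-∁-edgeless (B i) hits

partition-inside : ∀ G {j} (B : Fin j → Biclique (n G)) → IsPartition (Edge G) B → ∀ S →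
                   HasBicliquePartition (induced G S) (count (λ i → meets? S (B i)))
partition-inside G B part S =
  prune (restrict S ∘ B) (λ i → meets? S (B i))
        (λ i ¬meets u v e → ¬meets (restrict-edge⇒meets {S = S} {B i} e))
        (isPartition-induced G {B = B} S part)

fBoundedBy-recurrence : ∀ k b c → fBoundedBy k b → fBoundedBy (k / 4) c → fBoundedBy (suc k) (b + c)
fBoundedBy-recurrence k b c f≤b f≤c G (j , j≤1+k , bs , part) with m≤n⇒m<n∨m≡n j≤1+k
... | inj₁ (s≤s j≤k) = colourable-mono {G = G} (m≤m+n b c) (f≤b G (j , j≤k , bs , part))
... | inj₂ refl =
  let i , s , few = few-meet-some-side (lookup bs) (partition-distinct {B = lookup bs} part)
      S = side (lookup bs i) s
  in colourable-split G S
       (f≤b (induced G (∁ S))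
            (partition-outside G (lookup bs) part i (edge-hits-side (lookup bs i) s)))
       (f≤c (induced G S) (partitionableBy-mono few (partition-inside G (lookup bs) part S)))

fBoundedBy-zero : fBoundedBy 0 1
fBoundedBy-zero G (.0 , z≤n , [] , _ , cover , _) =
  (λ _ → zero) , λ u v e → ⊥-elim (¬Fin0 (proj₁ (cover u v e)))

fBoundedBy⇒1≤ : ∀ {k c} → fBoundedBy k c → 1 ≤ c
fBoundedBy⇒1≤ {c = zero}  f≤0 =
  ⊥-elim (¬Fin0 (proj₁ (f≤0 K₁ (0 , z≤n , [] , (λ ()) , (λ u v ()) , (λ ()))) zero))
  where
  K₁ : Graph
  K₁ = record { n = 1 ; adj = λ _ _ → false ; adj-sym = λ _ _ → refl ; irrefl = λ _ → refl }
fBoundedBy⇒1≤ {c = suc _} _   = s≤s z≤n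

fBoundedBy-mono : ∀ {k c c'} → c ≤ c' → fBoundedBy k c → fBoundedBy k c'
fBoundedBy-mono c≤c' f≤c G p = colourable-mono {G = G} c≤c' (f≤c G p)

fBoundedBy-anti : ∀ {k k' c} → k' ≤ k → fBoundedBy k c → fBoundedBy k' c
fBoundedBy-anti k'≤k f≤c G p = f≤c G (partitionableBy-mono k'≤k p)

fBoundedBy-linear : ∀ k c → fBoundedBy (k / 4) c → fBoundedBy k (suc k * c)
fBoundedBy-linear k c f≤c = go k ≤-refl
  where
  go : ∀ k' → k' ≤ k → fBoundedBy k' (suc k' * c)
  go zero     _    =
    fBoundedBy-mono (subst (1 ≤_) (sym (*-identityˡ c)) (fBoundedBy⇒1≤ f≤c)) fBoundedBy-zero
  go (suc k') k'<k = subst (fBoundedBy (suc k')) (+-comm (suc k' * c) c)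
    (fBoundedBy-recurrence k' _ c (go k' (<⇒≤ k'<k))
                                  (fBoundedBy-anti (/-monoˡ-≤ 4 (<⇒≤ k'<k)) f≤c))

fBoundedBy-2^[j²/4] : ∀ j k → 4 * k < 2 ^ suc j → ∃ λ c → fBoundedBy k c × c ^ 4 ≤ 2 ^ (j * j)
fBoundedBy-2^[j²/4] j             zero    _  = 1 , fBoundedBy-zero , m^n>0 2 (j * j)
fBoundedBy-2^[j²/4] zero          (suc k) 4k<2 =
  ⊥-elim (<⇒≱ 4k<2 (≤-trans (s≤s (s≤s z≤n)) (m≤m*n 4 (suc k))))
fBoundedBy-2^[j²/4] (suc zero)    (suc k) 4k<4 = ⊥-elim (<⇒≱ 4k<4 (m≤m*n 4 (suc k)))
fBoundedBy-2^[j²/4] (suc (suc j)) k 4k<2^[3+j] =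
  let c , f≤c , c⁴≤2^j² = fBoundedBy-2^[j²/4] j (k / 4) (≤-<-trans 4[k/4]≤k k<2^[1+j])
  in suc k * c , fBoundedBy-linear k c f≤c , (begin
    (suc k * c) ^ 4                     ≡⟨ ^-distrib-* (suc k) c 4 ⟩
    suc k ^ 4 * c ^ 4                   ≤⟨ *-mono-≤ (^-monoˡ-≤ 4 k<2^[1+j]) c⁴≤2^j² ⟩
    (2 ^ suc j) ^ 4 * 2 ^ (j * j)       ≡⟨ cong (_* 2 ^ (j * j)) (^-*-assoc 2 (suc j) 4) ⟩
    2 ^ (suc j * 4) * 2 ^ (j * j)       ≡⟨ ^-distribˡ-+-* 2 (suc j * 4) (j * j) ⟨
    2 ^ (suc j * 4 + j * j)             ≡⟨ cong (2 ^_) (square-step j) ⟩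
    2 ^ (suc (suc j) * suc (suc j))     ∎)
  where
  open ≤-Reasoning
  k<2^[1+j] : k < 2 ^ suc j
  k<2^[1+j] =
    *-cancelˡ-< 4 k (2 ^ suc j) (subst (4 * k <_) (sym (*-assoc 2 2 (2 ^ suc j))) 4k<2^[3+j])
  4[k/4]≤k : 4 * (k / 4) ≤ k
  4[k/4]≤k = subst (_≤ k) (*-comm (k / 4) 4) (m/n*n≤m k 4)
  square-step : ∀ j → suc j * 4 + j * j ≡ suc (suc j) * suc (suc j)
  square-step = solve-∀

∃-2^j≤x<2^[1+j] : ∀ x → 1 ≤ x → ∃ λ j → 2 ^ j ≤ x × x < 2 ^ suc j
∃-2^j≤x<2^[1+j] (suc zero)    _ = 0 , s≤s z≤n , s≤s (s≤s z≤n)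
∃-2^j≤x<2^[1+j] (suc (suc x)) _ with ∃-2^j≤x<2^[1+j] (suc x) (s≤s z≤n)
... | j , 2^j≤1+x , 1+x<2^[1+j] with m≤n⇒m<n∨m≡n 1+x<2^[1+j]
...   | inj₁ 2+x<2^[1+j] = j , ≤-trans 2^j≤1+x (n≤1+n _) , 2+x<2^[1+j]
...   | inj₂ 2+x≡2^[1+j] =
  suc j , ≤-reflexive (sym 2+x≡2^[1+j]) ,
  subst (_< 2 ^ suc (suc j)) (sym 2+x≡2^[1+j]) (^-monoʳ-< 2 (s≤s (s≤s z≤n)) (n<1+n (suc j)))

belowBound : ∀ {k c} j → 2 ^ j ≤ 4 * k → c ^ 4 ≤ 2 ^ (j * j) → BelowBound k c
belowBound {k} {c} j 2^j≤4k c⁴≤2^j² m n _ [4k]ⁿ<2^m = begin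
  c ^ (4 * (n * n))       ≡⟨ ^-*-assoc c 4 (n * n) ⟨
  (c ^ 4) ^ (n * n)       ≤⟨ ^-monoˡ-≤ (n * n) c⁴≤2^j² ⟩
  (2 ^ (j * j)) ^ (n * n) ≡⟨ ^-*-assoc 2 (j * j) (n * n) ⟩
  2 ^ (j * j * (n * n))   ≡⟨ cong (2 ^_) (square-* j n) ⟩
  2 ^ (j * n * (j * n))   ≤⟨ ^-monoʳ-≤ 2 (*-mono-≤ jn≤m jn≤m) ⟩
  2 ^ (m * m)             ∎
  where
  open ≤-Reasoning
  jn≤m : j * n ≤ m
  jn≤m = ≰⇒≥ λ m≤jn → <⇒≱ [4k]ⁿ<2^m (begin
    2 ^ m       ≤⟨ ^-monoʳ-≤ 2 m≤jn ⟩
    2 ^ (j * n) ≡⟨ ^-*-assoc 2 j n ⟨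
    (2 ^ j) ^ n ≤⟨ ^-monoˡ-≤ n 2^j≤4k ⟩
    (4 * k) ^ n ∎)
  square-* : ∀ j n → j * j * (n * n) ≡ j * n * (j * n)
  square-* = solve-∀

theorem1 : (∀ (k b c : ℕ) → fBoundedBy k b → fBoundedBy (k / 4) c → fBoundedBy (suc k) (b + c))
    × (∀ (k : ℕ) → 1 ≤ k → ∀ (G : Graph) → HasBicliquePartition G k
        → Σ ℕ λ c → Colourable G c × BelowBound k c)
theorem1 = fBoundedBy-recurrence , bound
  where
  bound : ∀ k → 1 ≤ k → ∀ G → HasBicliquePartition G k →
          Σ ℕ λ c → Colourable G c × BelowBound k c
  bound k 1≤k G p =
    let j , 2^j≤4k , 4k<2^[1+j] = ∃-2^j≤x<2^[1+j] (4 * k) (≤-trans 1≤k (m≤n*m k 4))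
        c , f≤c , c⁴≤2^j² = fBoundedBy-2^[j²/4] j k 4k<2^[1+j]
    in c , f≤c G p , belowBound {k} j 2^j≤4k c⁴≤2^j²
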